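{- For every $n\geq 2$, there is a poset $P$ excluding $\mathbf{3}+\mathbf{3}$ such that $\dim(P)\geq n$ and every convex subposet $Q$ of $P$ satisfies $\dim(Q)\leq h(Q)+1$, where $h(Q)$ denotes the height of $Q$.
   Context: $\mathbf{3}+\mathbf{3}$ is the disjoint union of two $3$-element chains with all points of one incomparable to all points of the other; $P$ excludes it if no subposet is isomorphic to it. A subposet $Q$ is convex if $y\in Q$ whenever $x,z\in Q$ and $x<y<z$ in $P$. $\dim$ denotes Dushnik–Miller dimension. -}

module Defs where

open import Level using (0ℓ)
open import Data.Nat using (ℕ; _≤_; _<_; _+_; suc)
open import Data.Fin using (Fin; toℕ)
open import Data.Fin.Subset using (Subset; _∈_)
open import Data.Product using (Σ; ∃; _×_; _,_; proj₁)
open import Data.Sum using (_⊎_)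
open import Function.Bundles using (_⇔_)
open import Function.Definitions using (Injective)
open import Relation.Binary.Core using (Rel)
open import Relation.Binary.Structures using (IsPartialOrder; IsTotalOrder)
open import Relation.Binary.PropositionalEquality using (_≡_)
open import Relation.Nullary using (¬_)

record FinPoset : Set₁ where
  field
    size : ℕ
    _≼_ : Rel (Fin size) 0ℓ
    isPartialOrder : IsPartialOrder _≡_ _≼_

module _ {A : Set} (R : Rel A 0ℓ) where

  Strict : Rel A 0ℓ
  Strict x y = R x y × ¬ (x ≡ y)

  Comparable : Rel A 0ℓ
  Comparable x y = R x y ⊎ R y x

  Realizer : ℕ → Set₁
  Realizer t = Σ (Fin t → Rel A 0ℓ) λ L →
    ((i : Fin t) → IsTotalOrder _≡_ (L i)) ×
    ((x y : A) → R x y ⇔ ((i : Fin t) → L i x y))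

  DimLE : ℕ → Set₁
  DimLE t = Σ ℕ λ k → k ≤ t × Realizer k

  DimGE : ℕ → Set₁
  DimGE n = (k : ℕ) → k < n → ¬ Realizer k

  Chain : ℕ → Set
  Chain k = Σ (Fin k → A) λ f → Injective _≡_ _≡_ f × ((i j : Fin k) → Comparable (f i) (f j))

  IsHeight : ℕ → Set
  IsHeight h = Chain h × ((k : ℕ) → Chain k → k ≤ h)

-- The poset 3+3 on Fin 6: {0<1<2} and {3<4<5}, the two chains mutually incomparable.
SameBlock : Fin 6 → Fin 6 → Set
SameBlock i j = (toℕ i < 3 × toℕ j < 3) ⊎ (3 ≤ toℕ i × 3 ≤ toℕ j)

ThreePlusThree : Rel (Fin 6) 0ℓ
ThreePlusThree i j = toℕ i ≤ toℕ j × SameBlock i j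

SubCarrier : (P : FinPoset) → Subset (FinPoset.size P) → Set
SubCarrier P Q = Σ (Fin (FinPoset.size P)) λ x → x ∈ Q

SubRel : (P : FinPoset) (Q : Subset (FinPoset.size P)) → Rel (SubCarrier P Q) 0ℓ
SubRel P Q a b = FinPoset._≼_ P (proj₁ a) (proj₁ b)

Contains3+3 : FinPoset → Set
Contains3+3 P = Σ (Fin 6 → Fin (FinPoset.size P)) λ f →
  (i j : Fin 6) → ThreePlusThree i j ⇔ FinPoset._≼_ P (f i) (f j)

Excludes3+3 : FinPoset → Set
Excludes3+3 P = ¬ Contains3+3 P

Convex : (P : FinPoset) → Subset (FinPoset.size P) → Set
Convex P Q = (x y z : Fin (FinPoset.size P)) → x ∈ Q → z ∈ Q →
  Strict (FinPoset._≼_ P) x y → Strict (FinPoset._≼_ P) y z → y ∈ Q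

-- P is a standard example lo i < hi j (i ≠ j; i, j < n) together with a spine: a chain of
-- n blocks of K = n + 2 points, where lo i lies below the blocks i, i+1, … and block b lies
-- below hi j iff b < j.
--   * The middle of every 3-element chain lies on the spine, which is a chain; hence P
--     excludes 3+3 (excludes3+3).  The standard example gives dim P ≥ n (standardExample).
--   * Linear extensions are described by lexicographic keys: keyRealizer turns a family of
--     keys that respects the order and reverses every non-relation into a realizer.  The
--     keys O₁, O₂, O₃ and one cut per index realize every subposet with n + 3 orders; O₁, O₂
--     and a single cut r suffice when the lower points of Q have indices ≥ r and its upper
--     points indices ≤ r.
--   * For convex Q, cutOrInversion yields either such a cut, and dim ≤ 3 gives
--     dim ≤ height + 1 (dimLE-height+1); or lo i, hi j ∈ Q with i < j, in which case Q
--     contains block i, so height ≥ n + 2 and n + 3 orders suffice.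
module Submission where

open import Defs
open import Data.Nat using (ℕ; _≤_; _+_)
open import Data.Fin.Subset using (Subset)
open import Data.Product using (Σ; _×_)

open import Level using (0ℓ)
open import Data.Nat using (zero; suc; _*_; _∸_; _<_; z≤n; s≤s; s≤s⁻¹)
  renaming (_≤?_ to _≤ℕ?_; _<?_ to _<ℕ?_)
open import Data.Nat.Properties
  using (<-isStrictTotalOrder; ≮⇒≥; ≤∧≢⇒<; n≮0; ∸-monoʳ-<; <⇒≤; <-cmp; anyUpTo?; +-comm;
         ≤-refl; ≤-antisym; ≤-trans; ≤-<-trans; <-≤-trans; <-irrefl; m≤n⇒m<n∨m≡n; ≰⇒>)
  renaming (_≟_ to _≟ℕ_)
open import Data.Fin using (Fin; toℕ; _≟_) renaming (suc to fsuc; _<_ to _<ᶠ_; _≤_ to _≤ᶠ_)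
open import Data.Fin.Patterns using (0F; 1F; 2F; 3F; 4F; 5F)
open import Data.Fin.Properties
  using (toℕ-injective; toℕ<n; ¬∀⟶∃¬; pigeonhole; +↔⊎; *↔×; any?)
  renaming (<⇒≢ to <⇒≢ᶠ; <-cmp to <-cmpᶠ; <-isStrictTotalOrder to <ᶠ-isStrictTotalOrder)
open import Data.Fin.Subset using (_∈_)
open import Data.Fin.Subset.Properties using (_∈?_)
open import Data.Vec.Properties.WithK using ([]=-irrelevant)
open import Data.Product using (∃₂; _,_; proj₁; proj₂)
open import Data.Product.Relation.Binary.Pointwise.NonDependent using (Pointwise; ≡×≡⇒≡)
open import Data.Product.Relation.Binary.Lex.Strict using (×-Lex; ×-isStrictTotalOrder)
open import Data.Sum using (_⊎_; inj₁; inj₂)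
import Data.Sum as Sum
open import Data.Sum.Function.Propositional using (_⊎-↔_)
open import Data.Unit using (⊤; tt)
open import Data.Empty using (⊥; ⊥-elim)
open import Function using (_on_)
open import Function.Bundles using (_↔_; Inverse; mk⇔; Equivalence)
open import Function.Construct.Composition using (_↔-∘_)
open import Function.Construct.Identity using (↔-id)
open import Function.Definitions using (Injective)
open import Relation.Binary.Core using (Rel)
open import Relation.Binary.Definitions using (Trichotomous; tri<; tri≈; tri>)
open import Relation.Binary.Structures using (IsStrictTotalOrder; IsTotalOrder; IsPartialOrder)
open import Relation.Binary.PropositionalEquality
  using (_≡_; _≢_; refl; sym; trans; cong; subst; subst₂; isEquivalence; resp₂; module ≡-Reasoning)
import Relation.Binary.Construct.On as On
import Relation.Binary.Construct.StrictToNonStrict as ToNonStrict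
open import Relation.Nullary using (¬_; Dec; yes; no; ¬?)
import Relation.Nullary.Decidable as Dec
open import Relation.Nullary.Decidable using (True; False; toWitness; toWitnessFalse; _×-dec_; _⊎-dec_)
open import Relation.Unary using (Decidable)

module InducedLinearOrder {A B : Set} {_≈_ _<_ : Rel B 0ℓ} (sto : IsStrictTotalOrder _≈_ _<_)
    (f : A → B) (f-injective : ∀ {x y} → f x ≈ f y → x ≡ y) where

  private
    module S = IsStrictTotalOrder sto
    module T = IsTotalOrder (On.isTotalOrder f (ToNonStrict.isTotalOrder _≈_ _<_ sto))

  _≤ᵢ_ : Rel A 0ℓ
  _≤ᵢ_ = ToNonStrict._≤_ _≈_ _<_ on f

  isTotalOrder : IsTotalOrder _≡_ _≤ᵢ_
  isTotalOrder = record
    { isPartialOrder = record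
      { isPreorder = record
        { isEquivalence = isEquivalence
        ; reflexive = λ { refl → T.refl }
        ; trans = T.trans }
      ; antisym = λ x≤y y≤x → f-injective (T.antisym x≤y y≤x) }
    ; total = T.total }

  ≤⇒≯ : ∀ {x y} → x ≤ᵢ y → ¬ (f y < f x)
  ≤⇒≯ (inj₁ fx<fy) fy<fx = S.asym fx<fy fy<fx
  ≤⇒≯ (inj₂ fx≈fy) fy<fx = S.irrefl (S.Eq.sym fx≈fy) fy<fx

Key : Set
Key = ℕ × ℕ × ℕ

_<ᴷ_ : Rel Key 0ℓ
_<ᴷ_ = ×-Lex _≡_ _<_ (×-Lex _≡_ _<_ _<_)

<ᴷ-first : ∀ {a b c a' b' c'} → a < a' → (a , b , c) <ᴷ (a' , b' , c')
<ᴷ-first = inj₁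

<ᴷ-second : ∀ {a b c b' c'} → b < b' → (a , b , c) <ᴷ (a , b' , c')
<ᴷ-second b<b' = inj₂ (refl , inj₁ b<b')

<ᴷ-third : ∀ {a b c c'} → c < c' → (a , b , c) <ᴷ (a , b , c')
<ᴷ-third c<c' = inj₂ (refl , inj₂ (refl , c<c'))

<ᴷ-tiebreak-isStrictTotalOrder : IsStrictTotalOrder (Pointwise (Pointwise _≡_ (Pointwise _≡_ _≡_)) _≡_)
                                                    (×-Lex (Pointwise _≡_ (Pointwise _≡_ _≡_)) _<ᴷ_ _<_)
<ᴷ-tiebreak-isStrictTotalOrder = ×-isStrictTotalOrder
  (×-isStrictTotalOrder <-isStrictTotalOrder (×-isStrictTotalOrder <-isStrictTotalOrder <-isStrictTotalOrder))
  <-isStrictTotalOrder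

module _ {A : Set} (R : Rel A 0ℓ) where

  chainOfOne : (∀ a → R a a) → A → Chain R 1
  chainOfOne reflexive a = (λ _ → a) , (λ { {0F} {0F} _ → refl }) , λ _ _ → inj₁ (reflexive a)

  chainOfTwo : (∀ a → R a a) → ∀ {a b} → Strict R a b → Chain R 2
  chainOfTwo reflexive {a} {b} (r , a≢b) = pair , injective , comparable
    where
    pair : Fin 2 → A
    pair 0F = a
    pair 1F = b
    injective : Injective _≡_ _≡_ pair
    injective {0F} {0F} _ = refl
    injective {0F} {1F} e = ⊥-elim (a≢b e)
    injective {1F} {0F} e = ⊥-elim (a≢b (sym e))
    injective {1F} {1F} _ = refl
    comparable : ∀ u v → Comparable R (pair u) (pair v)
    comparable 0F 0F = inj₁ (reflexive a)
    comparable 0F 1F = inj₁ r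
    comparable 1F 0F = inj₂ r
    comparable 1F 1F = inj₁ (reflexive b)

  -- Each linear order of a realizer can put bᵢ
  -- below aᵢ for at most one i, since bⱼ < aⱼ and bᵢ < aᵢ in one order would force
  -- aᵢ < bⱼ < aⱼ < bᵢ.
  standardExample : ∀ {n} (a b : Fin n → A) → (∀ {i j} → i ≢ j → R (a i) (b j)) →
    (∀ i → ¬ R (a i) (b i)) → DimGE R n
  standardExample a b crossing critical k k<n (L , total , realizes) = clash
    where
    module L (o : Fin k) = IsTotalOrder (total o)
    inAll : ∀ {x y} → (∀ o → L o x y) → R x y
    inAll = Equivalence.from (realizes _ _)
    inEach : ∀ {x y} → R x y → ∀ o → L o x y
    inEach = Equivalence.to (realizes _ _)
    a≢b : ∀ i → a i ≢ b i
    a≢b i e = critical i (inAll (λ o → subst (L o (a i)) e (L.refl o)))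
    below? : ∀ i o → Dec (L o (a i) (b i))
    below? i o with L.total o (a i) (b i)
    ... | inj₁ le = yes le
    ... | inj₂ ge = no (λ le → a≢b i (L.antisym o le ge))
    reverser : ∀ i → Σ (Fin k) λ o → ¬ L o (a i) (b i)
    reverser i = ¬∀⟶∃¬ k _ (below? i) (λ all → critical i (inAll all))
    flipped : ∀ {o x y} → ¬ L o x y → L o y x
    flipped {o} {x} {y} ¬le with L.total o x y
    ... | inj₁ le = ⊥-elim (¬le le)
    ... | inj₂ ge = ge
    clash : ⊥
    clash with pigeonhole k<n (λ i → proj₁ (reverser i))
    ... | i , j , i<j , same = proj₂ (reverser i) aᵢ≤bᵢ
      where
      o : Fin k
      o = proj₁ (reverser i)
      i≢j : i ≢ j
      i≢j = <⇒≢ᶠ i<j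
      bⱼ≤aⱼ : L o (b j) (a j)
      bⱼ≤aⱼ = subst (λ o' → L o' (b j) (a j)) (sym same) (flipped (proj₂ (reverser j)))
      aᵢ≤bᵢ : L o (a i) (b i)
      aᵢ≤bᵢ = L.trans o (inEach (crossing i≢j) o) (L.trans o bⱼ≤aⱼ (inEach (crossing (λ e → i≢j (sym e))) o))

  dimLE-fromChain : ∀ {k h} → Chain R k → IsHeight R h → Realizer R (suc k) → DimLE R (h + 1)
  dimLE-fromChain {k} {h} chain (_ , tallest) realizer =
    suc k , subst (suc k ≤_) (+-comm 1 h) (s≤s (tallest k chain)) , realizer

  module _ {N : ℕ} (ι : A → Fin N) (ι-injective : Injective _≡_ _≡_ ι) where

    keyRealizer : (t : ℕ) (key : Fin t → A → Key) →
      (∀ o {a b} → R a b → a ≡ b ⊎ key o a <ᴷ key o b) →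
      (∀ a b → R a b ⊎ Σ (Fin t) λ o → key o b <ᴷ key o a) →
      Realizer R t
    keyRealizer t key respects reverses = order , L.isTotalOrder , λ a b → mk⇔ (to a b) (from a b)
      where
      module L (o : Fin t) = InducedLinearOrder <ᴷ-tiebreak-isStrictTotalOrder
        (λ a → key o a , toℕ (ι a)) (λ e → ι-injective (toℕ-injective (proj₂ e)))
      order : Fin t → Rel A 0ℓ
      order o = L._≤ᵢ_ o
      to : ∀ a b → R a b → ∀ o → order o a b
      to a b r o with respects o r
      ... | inj₁ refl = IsTotalOrder.refl (L.isTotalOrder o)
      ... | inj₂ k<k = inj₁ (inj₁ k<k)
      from : ∀ a b → (∀ o → order o a b) → R a b
      from a b below with reverses a b
      ... | inj₁ r = r
      ... | inj₂ (o , k<k) = ⊥-elim (L.≤⇒≯ o (below o) (inj₁ k<k))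

    -- An antichain has dimension at most 2: order by ι, and by ι reversed.
    antichainRealizer : (∀ a → R a a) → (∀ {a b} → R a b → a ≡ b) → Realizer R 2
    antichainRealizer reflexive antichain = keyRealizer 2 key (λ _ r → inj₁ (antichain r)) reverses
      where
      position : A → ℕ
      position a = toℕ (ι a)
      key : Fin 2 → A → Key
      key 0F a = (position a , 0 , 0)
      key 1F a = (N ∸ position a , 0 , 0)
      reverses : ∀ a b → R a b ⊎ Σ (Fin 2) λ o → key o b <ᴷ key o a
      reverses a b with <-cmp (position a) (position b)
      ... | tri< lt _ _ = inj₂ (1F , <ᴷ-first (∸-monoʳ-< lt (<⇒≤ (toℕ<n (ι b)))))
      ... | tri≈ _ e _ = inj₁ (subst (R a) (ι-injective (toℕ-injective e)) (reflexive a))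
      ... | tri> _ _ gt = inj₂ (0F , <ᴷ-first gt)

    emptyRealizer : ¬ A → Realizer R 0
    emptyRealizer empty = (λ ()) , (λ ()) , λ a → ⊥-elim (empty a)

    -- A reflexive relation of dimension at most 3 has dimension at most height + 1:
    -- a strict pair gives height ≥ 2, an antichain needs 2 orders, the empty set none.
    dimLE-height+1 : (∀ a → R a a) → Dec (∃₂ λ a b → Strict R a b) → Dec A → Realizer R 3 →
      (h : ℕ) → IsHeight R h → DimLE R (h + 1)
    dimLE-height+1 reflexive strictPair? inhabited? realizer h height with strictPair?
    ... | yes (_ , _ , a<b) = dimLE-fromChain (chainOfTwo reflexive a<b) height realizer
    ... | no noStrictPair with inhabited?
    ...   | yes a = dimLE-fromChain (chainOfOne reflexive a) height (antichainRealizer reflexive antichain)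
      where
      antichain : ∀ {a b} → R a b → a ≡ b
      antichain {a} {b} r with ι a ≟ ι b
      ... | yes e = ι-injective e
      ... | no ne = ⊥-elim (noStrictPair (a , b , r , λ e → ne (cong ι e)))
    ...   | no empty = 0 , z≤n , emptyRealizer empty

cutOrInversion : {S C : ℕ → Set} → Decidable S → Decidable C → (m : ℕ) → (∀ {j} → C j → j < m) →
  (Σ ℕ λ r → (∀ {i} → S i → r ≤ i) × (∀ {j} → C j → j ≤ r)) ⊎ (∃₂ λ i j → S i × C j × i < j)
cutOrInversion S? C? zero bounded = inj₁ (0 , (λ _ → z≤n) , (λ Cj → ⊥-elim (n≮0 (bounded Cj))))
cutOrInversion {S} {C} S? C? (suc m) bounded with C? m
... | no ¬Cm = cutOrInversion S? C? m (λ Cj → ≤∧≢⇒< (s≤s⁻¹ (bounded Cj)) (λ { refl → ¬Cm Cj }))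
... | yes Cm with anyUpTo? S? m
...   | yes (i , i<m , Si) = inj₂ (i , m , Si , Cm , i<m)
...   | no noneBelow = inj₁ (m , (λ Si → ≮⇒≥ (λ i<m → noneBelow (_ , i<m , Si))) , (λ Cj → s≤s⁻¹ (bounded Cj)))

ThreePlusThree? : ∀ i j → Dec (ThreePlusThree i j)
ThreePlusThree? i j = (toℕ i ≤ℕ? toℕ j) ×-dec
  (((toℕ i <ℕ? 3) ×-dec (toℕ j <ℕ? 3)) ⊎-dec ((3 ≤ℕ? toℕ i) ×-dec (3 ≤ℕ? toℕ j)))

-- A poset excludes 3+3 as soon as the middle elements of any two 3-element chains are
-- comparable: an embedded 3+3 has incomparable middles 1 and 4.
module _ (P : FinPoset) where
  open FinPoset P

  excludes3+3 : (∀ {x y z x' y' z'} → Strict _≼_ x y → Strict _≼_ y z →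
                   Strict _≼_ x' y' → Strict _≼_ y' z' → Comparable _≼_ y y') →
                Excludes3+3 P
  excludes3+3 middlesComparable (f , embeds) =
    incomparable (middlesComparable (strict 0F 1F) (strict 1F 2F) (strict 3F 4F) (strict 4F 5F))
    where
    unrelated : ∀ i j {_ : False (ThreePlusThree? i j)} → ¬ f i ≼ f j
    unrelated i j {i≰j} fi≼fj = toWitnessFalse i≰j (Equivalence.from (embeds i j) fi≼fj)
    strict : ∀ i j {_ : True (ThreePlusThree? i j)} {_ : False (ThreePlusThree? j i)} → Strict _≼_ (f i) (f j)
    strict i j {i≤j} {j≰i} = Equivalence.to (embeds i j) (toWitness i≤j) ,
      λ e → unrelated j i {j≰i} (subst (_≼ f i) e (IsPartialOrder.refl isPartialOrder))
    incomparable : ¬ Comparable _≼_ (f 1F) (f 4F)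
    incomparable (inj₁ 1≼4) = unrelated 1F 4F 1≼4
    incomparable (inj₂ 4≼1) = unrelated 4F 1F 4≼1

module Construction (n : ℕ) where

  K : ℕ
  K = 2 + n

  Spine : Set
  Spine = Fin n × Fin K

  block : Spine → Fin n
  block = proj₁

  _<ˢ_ : Rel Spine 0ℓ
  _<ˢ_ = ×-Lex _≡_ _<ᶠ_ _<ᶠ_

  _≤ˢ_ : Rel Spine 0ℓ
  _≤ˢ_ = ToNonStrict._≤_ _≡_ _<ˢ_

  private
    module Lex = IsStrictTotalOrder (×-isStrictTotalOrder (<ᶠ-isStrictTotalOrder {n}) (<ᶠ-isStrictTotalOrder {K}))

  <ˢ-cmp : Trichotomous _≡_ _<ˢ_
  <ˢ-cmp σ τ with Lex.compare σ τ
  ... | tri< lt ne gt = tri< lt (λ e → ne (Lex.Eq.reflexive e)) gt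
  ... | tri≈ nl eq ng = tri≈ nl (≡×≡⇒≡ eq) ng
  ... | tri> lt ne gt = tri> lt (λ e → ne (Lex.Eq.reflexive e)) gt

  ≤ˢ-trans : ∀ {σ τ υ} → σ ≤ˢ τ → τ ≤ˢ υ → σ ≤ˢ υ
  ≤ˢ-trans = ToNonStrict.trans _≡_ _<ˢ_ isEquivalence (resp₂ _<ˢ_) Lex.trans

  ≤ˢ-antisym : ∀ {σ τ} → σ ≤ˢ τ → τ ≤ˢ σ → σ ≡ τ
  ≤ˢ-antisym = ToNonStrict.antisym _≡_ _<ˢ_ isEquivalence Lex.trans (λ { refl → Lex.irrefl Lex.Eq.refl })

  ≤ˢ-total : ∀ σ τ → σ ≤ˢ τ ⊎ τ ≤ˢ σ
  ≤ˢ-total = ToNonStrict.total _≡_ _<ˢ_ <ˢ-cmp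

  ≤ˢ-block : ∀ {σ τ} → σ ≤ˢ τ → block σ ≤ᶠ block τ
  ≤ˢ-block (inj₁ (inj₁ lt)) = <⇒≤ lt
  ≤ˢ-block (inj₁ (inj₂ (refl , _))) = ≤-refl
  ≤ˢ-block (inj₂ refl) = ≤-refl

  Point : Set
  Point = Fin n ⊎ Fin n ⊎ Spine

  pattern lo i = inj₁ i
  pattern hi j = inj₂ (inj₁ j)
  pattern sp σ = inj₂ (inj₂ σ)

  -- lo i < hi j iff i ≠ j; lo i lies below blocks i, i+1, …; block b lies below hi j iff b < j.
  -- So a chain lo i < spine < hi j passes through blocks i, …, j-1 and needs i < j.
  _⊑_ : Rel Point 0ℓ
  lo i ⊑ lo i' = i ≡ i'
  lo i ⊑ hi j = i ≢ j
  lo i ⊑ sp σ = i ≤ᶠ block σ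
  sp σ ⊑ sp τ = σ ≤ˢ τ
  sp σ ⊑ hi j = block σ <ᶠ j
  hi j ⊑ hi j' = j ≡ j'
  _ ⊑ _ = ⊥

  ⊑-refl : ∀ p → p ⊑ p
  ⊑-refl (lo i) = refl
  ⊑-refl (hi j) = refl
  ⊑-refl (sp σ) = inj₂ refl

  ⊑-trans : ∀ p q r → p ⊑ q → q ⊑ r → p ⊑ r
  ⊑-trans (lo _) (lo _) _ refl q⊑r = q⊑r
  ⊑-trans (lo _) (hi _) (hi _) p⊑q refl = p⊑q
  ⊑-trans (lo _) (sp _) (sp _) i≤σ σ≤τ = ≤-trans i≤σ (≤ˢ-block σ≤τ)
  ⊑-trans (lo _) (sp _) (hi _) i≤σ σ<j = <⇒≢ᶠ (≤-<-trans i≤σ σ<j)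
  ⊑-trans (sp _) (sp _) (sp _) σ≤τ τ≤υ = ≤ˢ-trans σ≤τ τ≤υ
  ⊑-trans (sp _) (sp _) (hi _) σ≤τ τ<j = ≤-<-trans (≤ˢ-block σ≤τ) τ<j
  ⊑-trans (sp _) (hi _) (hi _) σ<j refl = σ<j
  ⊑-trans (hi _) (hi _) _ refl q⊑r = q⊑r
  ⊑-trans (lo _) (hi _) (lo _) _ ()
  ⊑-trans (lo _) (hi _) (sp _) _ ()
  ⊑-trans (lo _) (sp _) (lo _) _ ()
  ⊑-trans (sp _) (sp _) (lo _) _ ()
  ⊑-trans (sp _) (hi _) (lo _) _ ()
  ⊑-trans (sp _) (hi _) (sp _) _ ()
  ⊑-trans (sp _) (lo _) _ () _
  ⊑-trans (hi _) (lo _) _ () _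
  ⊑-trans (hi _) (sp _) _ () _

  ⊑-antisym : ∀ p q → p ⊑ q → q ⊑ p → p ≡ q
  ⊑-antisym (lo _) (lo _) refl _ = refl
  ⊑-antisym (hi _) (hi _) refl _ = refl
  ⊑-antisym (sp _) (sp _) σ≤τ τ≤σ = cong sp (≤ˢ-antisym σ≤τ τ≤σ)
  ⊑-antisym (lo _) (hi _) _ ()
  ⊑-antisym (lo _) (sp _) _ ()
  ⊑-antisym (sp _) (hi _) _ ()
  ⊑-antisym (hi _) (lo _) () _
  ⊑-antisym (sp _) (lo _) () _
  ⊑-antisym (hi _) (sp _) () _

  size : ℕ
  size = n + (n + n * K)

  labelling : Fin size ↔ Point
  labelling = (↔-id (Fin n) ⊎-↔ (↔-id (Fin n) ⊎-↔ *↔×)) ↔-∘ ((↔-id (Fin n) ⊎-↔ +↔⊎) ↔-∘ +↔⊎)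

  point : Fin size → Point
  point = Inverse.to labelling

  label : Point → Fin size
  label = Inverse.from labelling

  point-label : ∀ p → point (label p) ≡ p
  point-label = Inverse.strictlyInverseˡ labelling

  label-point : ∀ x → label (point x) ≡ x
  label-point = Inverse.strictlyInverseʳ labelling

  point-injective : Injective _≡_ _≡_ point
  point-injective {x} {y} e = begin
    x                   ≡⟨ label-point x ⟨
    label (point x)     ≡⟨ cong label e ⟩
    label (point y)     ≡⟨ label-point y ⟩
    y                   ∎
    where open ≡-Reasoning

  _≼_ : Rel (Fin size) 0ℓ
  x ≼ y = point x ⊑ point y

  P : FinPoset
  P = record
    { size = size
    ; _≼_ = _≼_
    ; isPartialOrder = record
      { isPreorder = record
        { isEquivalence = isEquivalence
        ; reflexive = λ { {x} refl → ⊑-refl (point x) }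
        ; trans = λ {x} {y} {z} → ⊑-trans (point x) (point y) (point z) }
      ; antisym = λ p q → point-injective (⊑-antisym _ _ p q) } }

  onPoints : ∀ {x y} → Strict _≼_ x y → Strict _⊑_ (point x) (point y)
  onPoints (x≼y , x≢y) = x≼y , λ e → x≢y (point-injective e)

  labelled : ∀ {p q} → p ⊑ q → label p ≼ label q
  labelled {p} {q} p⊑q = subst₂ _⊑_ (sym (point-label p)) (sym (point-label q)) p⊑q

  unlabelled : ∀ {p q} → label p ≼ label q → p ⊑ q
  unlabelled {p} {q} = subst₂ _⊑_ (point-label p) (point-label q)

  label-injective : ∀ {p q} → label p ≡ label q → p ≡ q
  label-injective {p} {q} e = trans (sym (point-label p)) (trans (cong point e) (point-label q))

  labelOf : ∀ {x p} → point x ≡ p → x ≡ label p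
  labelOf {x} e = trans (sym (label-point x)) (cong label e)

  labelled-strict : ∀ {p q} → p ⊑ q → p ≢ q → Strict _≼_ (label p) (label q)
  labelled-strict p⊑q p≢q = labelled p⊑q , λ e → p≢q (label-injective e)

  sp-injective : ∀ {σ τ} → _≡_ {A = Point} (sp σ) (sp τ) → σ ≡ τ
  sp-injective refl = refl

  _⊑?_ : ∀ p q → Dec (p ⊑ q)
  lo i ⊑? lo i' = i ≟ i'
  lo i ⊑? hi j = ¬? (i ≟ j)
  lo i ⊑? sp σ = toℕ i ≤ℕ? toℕ (block σ)
  sp σ ⊑? sp τ = ToNonStrict.decidable′ _≡_ _<ˢ_ <ˢ-cmp σ τ
  sp σ ⊑? hi j = toℕ (block σ) <ℕ? toℕ j
  hi j ⊑? hi j' = j ≟ j'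
  sp _ ⊑? lo _ = no λ ()
  hi _ ⊑? lo _ = no λ ()
  hi _ ⊑? sp _ = no λ ()

  -- Any two strict 3-chains of P have their middles on the spine, which is a chain,
  -- so P excludes 3+3.
  middleOnSpine : ∀ {p q r} → Strict _⊑_ p q → Strict _⊑_ q r → Σ Spine λ σ → q ≡ sp σ
  middleOnSpine {lo _} {lo _} (refl , p≢q) _ = ⊥-elim (p≢q refl)
  middleOnSpine {q = hi _} {hi _} _ (refl , q≢r) = ⊥-elim (q≢r refl)
  middleOnSpine {q = sp σ} _ _ = σ , refl
  middleOnSpine {sp _} {lo _} (() , _) _
  middleOnSpine {hi _} {lo _} (() , _) _
  middleOnSpine {q = hi _} {lo _} _ (() , _)
  middleOnSpine {q = hi _} {sp _} _ (() , _)

  P-excludes3+3 : Excludes3+3 P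
  P-excludes3+3 = excludes3+3 P λ xy yz x'y' y'z' →
    spineComparable (middleOnSpine (onPoints xy) (onPoints yz)) (middleOnSpine (onPoints x'y') (onPoints y'z'))
    where
    spineComparable : ∀ {p q} → (Σ Spine λ σ → p ≡ sp σ) → (Σ Spine λ τ → q ≡ sp τ) → Comparable _⊑_ p q
    spineComparable (σ , refl) (τ , refl) = ≤ˢ-total σ τ

  P-dimGE : DimGE _≼_ n
  P-dimGE = standardExample _≼_ (λ i → label (lo i)) (λ j → label (hi j)) labelled (λ i i≼i → unlabelled i≼i refl)

  -- Keys for linear extensions of P.  On the spine a key is (a, block, 1 + offset), so a
  -- point keyed (a, b, 0) sits just below block b.
  spineKey : ℕ → Spine → Key
  spineKey a (b , u) = (a , toℕ b , suc (toℕ u))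

  spineKey-< : ∀ {a σ τ} → σ <ˢ τ → spineKey a σ <ᴷ spineKey a τ
  spineKey-< (inj₁ b<b') = <ᴷ-second b<b'
  spineKey-< (inj₂ (refl , u<u')) = <ᴷ-third (s≤s u<u')

  spineKey-≤ : ∀ {a σ τ} → σ ≤ˢ τ → _≡_ {A = Point} (sp σ) (sp τ) ⊎ spineKey a σ <ᴷ spineKey a τ
  spineKey-≤ (inj₁ σ<τ) = inj₂ (spineKey-< σ<τ)
  spineKey-≤ (inj₂ refl) = inj₁ refl

  belowBlock : ∀ {a k} σ → k ≤ toℕ (block σ) → (a , k , 0) <ᴷ spineKey a σ
  belowBlock σ k≤b with m≤n⇒m<n∨m≡n k≤b
  ... | inj₁ k<b = <ᴷ-second k<b
  ... | inj₂ refl = <ᴷ-third (s≤s z≤n)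

  Respects : (Point → Key) → Set
  Respects key = ∀ {p q} → p ⊑ q → p ≡ q ⊎ key p <ᴷ key q

  O₁ : Point → Key
  O₁ (lo i) = (0 , toℕ i , 0)
  O₁ (sp σ) = spineKey 0 σ
  O₁ (hi j) = (1 , toℕ j , 0)

  O₁-respects : Respects O₁
  O₁-respects {lo _} {lo _} refl = inj₁ refl
  O₁-respects {lo _} {hi _} _ = inj₂ (<ᴷ-first (s≤s z≤n))
  O₁-respects {lo _} {sp σ} i≤b = inj₂ (belowBlock σ i≤b)
  O₁-respects {sp _} {sp _} σ≤τ = spineKey-≤ σ≤τ
  O₁-respects {sp _} {hi _} _ = inj₂ (<ᴷ-first (s≤s z≤n))
  O₁-respects {hi _} {hi _} refl = inj₁ refl
  O₁-respects {sp _} {lo _} ()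
  O₁-respects {hi _} {lo _} ()
  O₁-respects {hi _} {sp _} ()

  O₂ : Point → Key
  O₂ (lo i) = (0 , n ∸ toℕ i , 0)
  O₂ (sp σ) = spineKey 1 σ
  O₂ (hi j) = (1 , toℕ j , 0)

  O₂-respects : Respects O₂
  O₂-respects {lo _} {lo _} refl = inj₁ refl
  O₂-respects {lo _} {hi _} _ = inj₂ (<ᴷ-first (s≤s z≤n))
  O₂-respects {lo _} {sp _} _ = inj₂ (<ᴷ-first (s≤s z≤n))
  O₂-respects {sp _} {sp _} σ≤τ = spineKey-≤ σ≤τ
  O₂-respects {sp _} {hi _} b<j = inj₂ (<ᴷ-second b<j)
  O₂-respects {hi _} {hi _} refl = inj₁ refl
  O₂-respects {sp _} {lo _} ()
  O₂-respects {hi _} {lo _} ()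
  O₂-respects {hi _} {sp _} ()

  O₃ : Point → Key
  O₃ (lo i) = (0 , toℕ i , 0)
  O₃ (sp σ) = spineKey 1 σ
  O₃ (hi j) = (2 , n ∸ toℕ j , 0)

  O₃-respects : Respects O₃
  O₃-respects {lo _} {lo _} refl = inj₁ refl
  O₃-respects {lo _} {hi _} _ = inj₂ (<ᴷ-first (s≤s z≤n))
  O₃-respects {lo _} {sp _} _ = inj₂ (<ᴷ-first (s≤s z≤n))
  O₃-respects {sp _} {sp _} σ≤τ = spineKey-≤ σ≤τ
  O₃-respects {sp _} {hi _} _ = inj₂ (<ᴷ-first (s≤s (s≤s z≤n)))
  O₃-respects {hi _} {hi _} refl = inj₁ refl
  O₃-respects {sp _} {lo _} ()
  O₃-respects {hi _} {lo _} ()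
  O₃-respects {hi _} {sp _} ()

  -- Cut m: the lower points other than lo m, the blocks before m, then hi m below lo m,
  -- then the blocks from m on, and the other upper points in decreasing order.
  Cut : ℕ → Point → Key
  Cut m (lo i) with toℕ i ≟ℕ m
  ... | yes _ = (2 , 1 , 0)
  ... | no _ = (0 , toℕ i , 0)
  Cut m (sp σ) with toℕ (block σ) <ℕ? m
  ... | yes _ = spineKey 1 σ
  ... | no _ = spineKey 3 σ
  Cut m (hi j) with toℕ j ≟ℕ m
  ... | yes _ = (2 , 0 , 0)
  ... | no _ = (4 , n ∸ toℕ j , 0)

  Cut-respects : ∀ m → Respects (Cut m)
  Cut-respects m {lo i} {lo _} refl = inj₁ refl
  Cut-respects m {lo i} {hi j} i≢j with toℕ i ≟ℕ m | toℕ j ≟ℕ m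
  ... | yes i≡m | yes j≡m = ⊥-elim (i≢j (toℕ-injective (trans i≡m (sym j≡m))))
  ... | yes _ | no _ = inj₂ (<ᴷ-first (s≤s (s≤s (s≤s z≤n))))
  ... | no _ | yes _ = inj₂ (<ᴷ-first (s≤s z≤n))
  ... | no _ | no _ = inj₂ (<ᴷ-first (s≤s z≤n))
  Cut-respects m {lo i} {sp σ} i≤b with toℕ i ≟ℕ m | toℕ (block σ) <ℕ? m
  ... | yes refl | yes b<m = ⊥-elim (<-irrefl refl (<-≤-trans b<m i≤b))
  ... | yes _ | no _ = inj₂ (<ᴷ-first (s≤s (s≤s (s≤s z≤n))))
  ... | no _ | yes _ = inj₂ (<ᴷ-first (s≤s z≤n))
  ... | no _ | no _ = inj₂ (<ᴷ-first (s≤s z≤n))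
  Cut-respects m {sp σ} {sp τ} σ≤τ with toℕ (block σ) <ℕ? m | toℕ (block τ) <ℕ? m
  ... | yes _ | yes _ = spineKey-≤ σ≤τ
  ... | yes _ | no _ = inj₂ (<ᴷ-first (s≤s (s≤s z≤n)))
  ... | no σ≮m | yes τ<m = ⊥-elim (σ≮m (≤-<-trans (≤ˢ-block σ≤τ) τ<m))
  ... | no _ | no _ = spineKey-≤ σ≤τ
  Cut-respects m {sp σ} {hi j} b<j with toℕ (block σ) <ℕ? m | toℕ j ≟ℕ m
  ... | yes _ | yes _ = inj₂ (<ᴷ-first (s≤s (s≤s z≤n)))
  ... | no b≮m | yes refl = ⊥-elim (b≮m b<j)
  ... | yes _ | no _ = inj₂ (<ᴷ-first (s≤s (s≤s z≤n)))
  ... | no _ | no _ = inj₂ (<ᴷ-first (s≤s (s≤s (s≤s (s≤s z≤n)))))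
  Cut-respects m {hi _} {hi _} refl = inj₁ refl
  Cut-respects m {sp _} {lo _} ()
  Cut-respects m {hi _} {lo _} ()
  Cut-respects m {hi _} {sp _} ()

  Cut-critical : ∀ {m} i → toℕ i ≡ m → Cut m (hi i) <ᴷ Cut m (lo i)
  Cut-critical {m} i i≡m with toℕ i ≟ℕ m
  ... | yes _ = <ᴷ-second (s≤s z≤n)
  ... | no i≢m = ⊥-elim (i≢m i≡m)

  Cut-upper : ∀ {m j j'} → j <ᶠ j' → toℕ j' ≤ m → Cut m (hi j') <ᴷ Cut m (hi j)
  Cut-upper {m} {j} {j'} j<j' j'≤m with toℕ j ≟ℕ m | toℕ j' ≟ℕ m
  ... | yes refl | _ = ⊥-elim (<-irrefl refl (<-≤-trans j<j' j'≤m))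
  ... | no _ | yes _ = <ᴷ-first (s≤s (s≤s (s≤s z≤n)))
  ... | no _ | no _ = <ᴷ-second (∸-monoʳ-< j<j' (<⇒≤ (toℕ<n j')))

  data Reversal : Point → Point → Set where
    byO₁ : ∀ {p q} → O₁ q <ᴷ O₁ p → Reversal p q
    byO₂ : ∀ {p q} → O₂ q <ᴷ O₂ p → Reversal p q
    critical : ∀ i → Reversal (lo i) (hi i)
    upperPair : ∀ {j j'} → j <ᶠ j' → Reversal (hi j) (hi j')

  related-or-reversal : ∀ p q → p ⊑ q ⊎ Reversal p q
  related-or-reversal (lo i) (lo i') with <-cmpᶠ i i'
  ... | tri< i<i' _ _ = inj₂ (byO₂ (<ᴷ-second (∸-monoʳ-< i<i' (<⇒≤ (toℕ<n i')))))
  ... | tri≈ _ i≡i' _ = inj₁ i≡i'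
  ... | tri> _ _ i'<i = inj₂ (byO₁ (<ᴷ-second i'<i))
  related-or-reversal (lo i) (hi j) with i ≟ j
  ... | yes refl = inj₂ (critical i)
  ... | no i≢j = inj₁ i≢j
  related-or-reversal (lo i) (sp σ) with toℕ i ≤ℕ? toℕ (block σ)
  ... | yes i≤b = inj₁ i≤b
  ... | no i≰b = inj₂ (byO₁ (<ᴷ-second (≰⇒> i≰b)))
  related-or-reversal (sp _) (lo _) = inj₂ (byO₂ (<ᴷ-first (s≤s z≤n)))
  related-or-reversal (sp σ) (sp τ) with <ˢ-cmp σ τ
  ... | tri< σ<τ _ _ = inj₁ (inj₁ σ<τ)
  ... | tri≈ _ σ≡τ _ = inj₁ (inj₂ σ≡τ)
  ... | tri> _ _ τ<σ = inj₂ (byO₁ (spineKey-< τ<σ))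
  related-or-reversal (sp σ) (hi j) with toℕ (block σ) <ℕ? toℕ j
  ... | yes b<j = inj₁ b<j
  ... | no b≮j = inj₂ (byO₂ (belowBlock σ (≮⇒≥ b≮j)))
  related-or-reversal (hi _) (lo _) = inj₂ (byO₁ (<ᴷ-first (s≤s z≤n)))
  related-or-reversal (hi _) (sp _) = inj₂ (byO₁ (<ᴷ-first (s≤s z≤n)))
  related-or-reversal (hi j) (hi j') with <-cmpᶠ j j'
  ... | tri< j<j' _ _ = inj₂ (upperPair j<j')
  ... | tri≈ _ j≡j' _ = inj₁ j≡j'
  ... | tri> _ _ j'<j = inj₂ (byO₁ (<ᴷ-second j'<j))

  fullKeys : Fin (3 + n) → Point → Key
  fullKeys 0F = O₁
  fullKeys 1F = O₂
  fullKeys 2F = O₃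
  fullKeys (fsuc (fsuc (fsuc m))) = Cut (toℕ m)

  fullKeys-respect : ∀ o → Respects (fullKeys o)
  fullKeys-respect 0F = O₁-respects
  fullKeys-respect 1F = O₂-respects
  fullKeys-respect 2F = O₃-respects
  fullKeys-respect (fsuc (fsuc (fsuc m))) = Cut-respects (toℕ m)

  fullKeys-reverse : ∀ {p q} → Reversal p q → Σ (Fin (3 + n)) λ o → fullKeys o q <ᴷ fullKeys o p
  fullKeys-reverse (byO₁ q<p) = 0F , q<p
  fullKeys-reverse (byO₂ q<p) = 1F , q<p
  fullKeys-reverse (critical i) = fsuc (fsuc (fsuc i)) , Cut-critical i refl
  fullKeys-reverse (upperPair {j' = j'} j<j') = 2F , <ᴷ-second (∸-monoʳ-< j<j' (<⇒≤ (toℕ<n j')))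

  -- Among compatible points the only critical pair is lo r, hi r, and every
  -- increasing pair of upper points ends at or below r, so O₁, O₂ and Cut r suffice.
  Compatible : ℕ → Point → Set
  Compatible r (lo i) = r ≤ toℕ i
  Compatible r (hi j) = toℕ j ≤ r
  Compatible r (sp _) = ⊤

  cutKeys : ℕ → Fin 3 → Point → Key
  cutKeys r 0F = O₁
  cutKeys r 1F = O₂
  cutKeys r 2F = Cut r

  cutKeys-respect : ∀ r o → Respects (cutKeys r o)
  cutKeys-respect r 0F = O₁-respects
  cutKeys-respect r 1F = O₂-respects
  cutKeys-respect r 2F = Cut-respects r

  cutKeys-reverse : ∀ {r p q} → Compatible r p → Compatible r q → Reversal p q →
    Σ (Fin 3) λ o → cutKeys r o q <ᴷ cutKeys r o p
  cutKeys-reverse _ _ (byO₁ q<p) = 0F , q<p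
  cutKeys-reverse _ _ (byO₂ q<p) = 1F , q<p
  cutKeys-reverse r≤i i≤r (critical i) = 2F , Cut-critical i (≤-antisym i≤r r≤i)
  cutKeys-reverse _ j'≤r (upperPair j<j') = 2F , Cut-upper j<j' j'≤r

  module OnSubset (Q : Subset size) where

    Elem : Set
    Elem = SubCarrier P Q

    pt : Elem → Point
    pt a = point (proj₁ a)

    elem-injective : Injective _≡_ _≡_ (proj₁ {B = _∈ Q})
    elem-injective {x , x∈Q} {_ , x∈Q'} refl = cong (x ,_) ([]=-irrelevant x∈Q x∈Q')

    pointRealizer : (t : ℕ) (key : Fin t → Point → Key) → (∀ o → Respects (key o)) →
      (∀ a b → Reversal (pt a) (pt b) → Σ (Fin t) λ o → key o (pt b) <ᴷ key o (pt a)) →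
      Realizer (SubRel P Q) t
    pointRealizer t key respects reverses = keyRealizer (SubRel P Q) proj₁ elem-injective t
      (λ o a → key o (pt a))
      (λ o a⊑b → Sum.map₁ (λ e → elem-injective (point-injective e)) (respects o a⊑b))
      (λ a b → Sum.map₂ (reverses a b) (related-or-reversal (pt a) (pt b)))

    fullRealizer : Realizer (SubRel P Q) (3 + n)
    fullRealizer = pointRealizer (3 + n) fullKeys fullKeys-respect (λ _ _ → fullKeys-reverse)

    cutRealizer : ∀ r → (∀ a → Compatible r (pt a)) → Realizer (SubRel P Q) 3
    cutRealizer r compatible = pointRealizer 3 (cutKeys r) (cutKeys-respect r)
      (λ a b → cutKeys-reverse (compatible a) (compatible b))

    HasLo HasHi : ℕ → Set
    HasLo k = Σ (Fin n) λ i → toℕ i ≡ k × label (lo i) ∈ Q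
    HasHi k = Σ (Fin n) λ j → toℕ j ≡ k × label (hi j) ∈ Q

    HasLo? : ∀ k → Dec (HasLo k)
    HasLo? k = any? λ i → (toℕ i ≟ℕ k) ×-dec (label (lo i) ∈? Q)

    HasHi? : ∀ k → Dec (HasHi k)
    HasHi? k = any? λ j → (toℕ j ≟ℕ k) ×-dec (label (hi j) ∈? Q)

    HasHi-bounded : ∀ {k} → HasHi k → k < n
    HasHi-bounded (j , refl , _) = toℕ<n j

    compatible : ∀ r → (∀ {i} → HasLo i → r ≤ i) → (∀ {j} → HasHi j → j ≤ r) → ∀ a → Compatible r (pt a)
    compatible r loAbove hiBelow (x , x∈Q) with point x in e
    ... | lo i = loAbove (i , refl , subst (_∈ Q) (labelOf e) x∈Q)
    ... | hi j = hiBelow (j , refl , subst (_∈ Q) (labelOf e) x∈Q)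
    ... | sp _ = tt

    -- If Q is convex and contains lo i and hi j with i < j, it contains the whole block i
    -- of the spine, which lies strictly between them: a chain of K elements.
    blockChain : Convex P Q → ∀ {i j} → i <ᶠ j → label (lo i) ∈ Q → label (hi j) ∈ Q → Chain (SubRel P Q) K
    blockChain convex {i} {j} i<j lo∈Q hi∈Q = element , injective , comparable
      where
      element : Fin K → Elem
      element u = label (sp (i , u)) , convex _ _ _ lo∈Q hi∈Q
        (labelled-strict {lo i} {sp (i , u)} ≤-refl λ ()) (labelled-strict {sp (i , u)} {hi j} i<j λ ())
      injective : Injective _≡_ _≡_ element
      injective e = cong proj₂ (sp-injective (label-injective (cong proj₁ e)))
      comparable : ∀ u v → Comparable (SubRel P Q) (element u) (element v)
      comparable u v = Sum.map (labelled {sp _} {sp _}) (labelled {sp _} {sp _}) (≤ˢ-total (i , u) (i , v))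

    nonempty? : Dec Elem
    nonempty? = any? (_∈? Q)

    strictPair? : Dec (∃₂ λ a b → Strict (SubRel P Q) a b)
    strictPair? = Dec.map′
      (λ (x , y , (x∈Q , y∈Q) , x⊑y , x≢y) → (x , x∈Q) , (y , y∈Q) , x⊑y , λ e → x≢y (cong proj₁ e))
      (λ ((x , x∈Q) , (y , y∈Q) , x⊑y , x≢y) → x , y , (x∈Q , y∈Q) , x⊑y , λ e → x≢y (elem-injective e))
      (any? λ x → any? λ y → ((x ∈? Q) ×-dec (y ∈? Q)) ×-dec ((point x ⊑? point y) ×-dec ¬? (x ≟ y)))

    convexDimension : Convex P Q → (h : ℕ) → IsHeight (SubRel P Q) h → DimLE (SubRel P Q) (h + 1)
    convexDimension convex h height with cutOrInversion HasLo? HasHi? n HasHi-bounded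
    ... | inj₂ (_ , _ , (i , refl , lo∈Q) , (j , refl , hi∈Q) , i<j) =
      dimLE-fromChain (SubRel P Q) (blockChain convex i<j lo∈Q hi∈Q) height fullRealizer
    ... | inj₁ (r , loAbove , hiBelow) =
      dimLE-height+1 (SubRel P Q) proj₁ elem-injective (λ a → ⊑-refl (pt a)) strictPair? nonempty?
        (cutRealizer r (compatible r loAbove hiBelow)) h height

proposition3p6 : (n : ℕ) → 2 ≤ n →
    Σ FinPoset λ P →
    Excludes3+3 P ×
    DimGE (FinPoset._≼_ P) n ×
    ((Q : Subset (FinPoset.size P)) → Convex P Q →
    (h : ℕ) → IsHeight (SubRel P Q) h → DimLE (SubRel P Q) (h + 1))
proposition3p6 n _ = P , P-excludes3+3 , P-dimGE , OnSubset.convexDimension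
  where open Construction n
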